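{- Let $s$ be a graphical sequence and $F,F'\in\mathcal{F}(s)$. Let $\Lambda$ be a set of trimmable leaves of $F$ and $F'$. Suppose that $(\tau_i)_{i=1}^r$ is an f-switch sequence transforming $F-\Lambda$ into $F'-\Lambda$. Then $(\tau_i)_{i=1}^r$ is an f-switch sequence transforming $F$ into $F'$.
   Context: Graphs are finite, simple, undirected and labeled with vertex set a subset of $[n]$. For a graphical sequence $s=(d_1,\dots,d_n)$, $\mathcal{F}(s)$ is the set of forests with vertex set $[n]$ in which vertex $i$ has degree $d_i$. A leaf is a vertex of degree 1; graphs in $\mathcal{F}(s)$ share the same set of leaves. A leaf $\ell$ is a trimmable leaf of $F$ and $F'$ if $\ell$ has the same neighbor in $F$ and in $F'$. $F-\Lambda$ denotes the graph obtained by deleting the vertices of $\Lambda$. The matrix $\binom{a\ b}{c\ d}$ is interchangeable in $G$ if $ab,cd\in E(G)$, $\{a,b\}\cap\{c,d\}=\varnothing$, $ac,bd\notin E(G)$; the 2-switch $\tau=\binom{a\ b}{c\ d}$ maps $G$ to $G-ab-cd+ac+bd$ in that case and to $G$ otherwise, and is nontrivial for $G$ if the matrix is interchangeable in $G$. A nontrivial 2-switch $\tau$ over a forest $H$ is an f-switch if $\tau(H)$ is a forest. A sequence $(\tau_i)_{i=1}^r$ is an f-switch sequence transforming $H$ into $H'$ if, with $H_0=H$ and $H_i=\tau_i(H_{i-1})$, each $\tau_i$ is an f-switch over $H_{i-1}$ and $H_r=H'$. -}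

module Defs where

open import Data.Nat using (ℕ; _≥_)
open import Data.Bool using (Bool; true; false; _∧_; _∨_; not; if_then_else_)
open import Data.Fin using (Fin)
open import Data.Fin.Properties using (_≟_)
open import Data.List using (List; []; _∷_; length; map; allFin; _++_)
open import Data.Nat.ListAction using (sum)
open import Data.List.Relation.Unary.Unique.Propositional using (Unique)
open import Data.Product using (_×_; Σ; ∃; _,_)
open import Relation.Nullary using (¬_)
open import Relation.Nullary.Decidable using (⌊_⌋)
open import Relation.Binary.PropositionalEquality using (_≡_)

-- A (labelled) graph whose vertex set is a subset of [n] = Fin n.
-- 'vert i' says whether i is a vertex, 'adj i j' whether ij is an edge.
record Graph (n : ℕ) : Set where
  constructor mkGraph
  field
    vert : Fin n → Bool
    adj  : Fin n → Fin n → Bool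
open Graph public

_≈G_ : {n : ℕ} → Graph n → Graph n → Set
G ≈G H = (∀ i → vert G i ≡ vert H i) × (∀ i j → adj G i j ≡ adj H i j)

record IsSimple {n : ℕ} (G : Graph n) : Set where
  field
    symm    : ∀ i j → adj G i j ≡ adj G j i
    loopless : ∀ i → adj G i i ≡ false
    edgeVert : ∀ i j → adj G i j ≡ true → vert G i ≡ true

data Path {n : ℕ} (G : Graph n) : List (Fin n) → Set where
  path-[]  : Path G []
  path-[x] : ∀ x → Path G (x ∷ [])
  path-∷   : ∀ x y vs → adj G x y ≡ true → Path G (y ∷ vs) → Path G (x ∷ y ∷ vs)

record Cycle {n : ℕ} (G : Graph n) : Set where
  field
    first  : Fin n
    rest   : List (Fin n)
    last   : Fin n
    long   : length rest ≥ 1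
    distinct : Unique (first ∷ rest ++ last ∷ [])
    walk   : Path G (first ∷ rest ++ last ∷ [])
    closed : adj G last first ≡ true

Forest : {n : ℕ} → Graph n → Set
Forest G = IsSimple G × ¬ Cycle G

deg : {n : ℕ} → Graph n → Fin n → ℕ
deg {n} G i = sum (map (λ j → if adj G i j then 1 else 0) (allFin n))

HasDegrees : {n : ℕ} → (Fin n → ℕ) → Graph n → Set
HasDegrees s G = (∀ i → vert G i ≡ true) × (∀ i → deg G i ≡ s i)

Graphical : {n : ℕ} → (Fin n → ℕ) → Set
Graphical {n} s = ∃ λ (G : Graph n) → IsSimple G × HasDegrees s G

InF : {n : ℕ} → (Fin n → ℕ) → Graph n → Set
InF s F = Forest F × HasDegrees s F

Leaf : {n : ℕ} → Graph n → Fin n → Set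
Leaf G ℓ = deg G ℓ ≡ 1

Trimmable : {n : ℕ} → Graph n → Graph n → Fin n → Set
Trimmable F F' ℓ = Leaf F ℓ × Leaf F' ℓ × ∃ λ v → (adj F ℓ v ≡ true) × (adj F' ℓ v ≡ true)

_-V_ : {n : ℕ} → Graph n → (Fin n → Bool) → Graph n
G -V Λ = mkGraph (λ i → vert G i ∧ not (Λ i))
                 (λ i j → adj G i j ∧ not (Λ i) ∧ not (Λ j))

record Matrix (n : ℕ) : Set where
  constructor mat
  field
    a b c d : Fin n

Interchangeable : {n : ℕ} → Matrix n → Graph n → Set
Interchangeable (mat a b c d) G =
  adj G a b ≡ true × adj G c d ≡ true ×
  ¬ a ≡ c × ¬ a ≡ d × ¬ b ≡ c × ¬ b ≡ d ×
  adj G a c ≡ false × adj G b d ≡ false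

sameEdge : {n : ℕ} → Fin n → Fin n → Fin n → Fin n → Bool
sameEdge x y u v = (⌊ x ≟ u ⌋ ∧ ⌊ y ≟ v ⌋) ∨ (⌊ x ≟ v ⌋ ∧ ⌊ y ≟ u ⌋)

-- G - ab - cd + ac + bd (the result of a 2-switch in the interchangeable case)
switch : {n : ℕ} → Matrix n → Graph n → Graph n
switch (mat a b c d) G =
  mkGraph (vert G)
          (λ x y → (adj G x y ∧ not (sameEdge x y a b ∨ sameEdge x y c d))
                   ∨ sameEdge x y a c ∨ sameEdge x y b d)

-- the 2-switch τ as a map on graphs (identity when not interchangeable)
2switch : {n : ℕ} → Matrix n → Graph n → Graph n
2switch τ@(mat a b c d) G =
  if adj G a b ∧ adj G c d ∧ not ⌊ a ≟ c ⌋ ∧ not ⌊ a ≟ d ⌋ ∧ not ⌊ b ≟ c ⌋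
     ∧ not ⌊ b ≟ d ⌋ ∧ not (adj G a c) ∧ not (adj G b d)
  then switch τ G else G

FSwitch : {n : ℕ} → Matrix n → Graph n → Set
FSwitch τ H = Forest H × Interchangeable τ H × Forest (2switch τ H)

data FSeq {n : ℕ} : List (Matrix n) → Graph n → Graph n → Set where
  fseq-[] : ∀ {H H'} → H ≈G H' → FSeq [] H H'
  fseq-∷  : ∀ {τ τs H H'} → FSwitch τ H → FSeq τs (2switch τ H) H' → FSeq (τ ∷ τs) H H'

-- Put the trimmed leaves back after every step: if G is H together with the
-- pendant edges of F at Λ, and τ is an f-switch over the Λ-free forest H, then
-- τ only touches vertices outside Λ, so it is interchangeable in G and keeps
-- that relation.  No cycle of G passes through a vertex of Λ, since such a
-- vertex has a single neighbour, so cycles of G are cycles of H and G stays a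
-- forest.  At the end F and F' have the same edges at Λ, hence G = F'.
module Submission where

open import Defs
open import Data.Nat using (ℕ; zero; suc; _≤_; _+_; s≤s)
open import Data.Nat.Properties using (≤-trans; m≤m+n; m≤n+m; +-comm; +-monoʳ-≤)
open import Data.Bool using (Bool; true; false; _∧_; _∨_; not; if_then_else_)
open import Data.Bool.Properties using (∧-identityʳ; ∨-identityʳ; ∧-zeroʳ)
open import Data.Fin using (Fin; zero; suc)
open import Data.Fin.Properties using (_≟_)
open import Data.List using (List; []; _∷_; _++_; tabulate)
open import Data.List.Properties using (map-tabulate)
open import Data.Nat.ListAction using (sum)
open import Data.List.Relation.Unary.All as All using (All; []; _∷_)
open import Data.List.Relation.Unary.All.Properties using (++⁺)
open import Data.List.Relation.Unary.AllPairs using (_∷_)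
open import Data.List.Relation.Unary.Unique.Propositional using (Unique)
open import Data.List.Membership.Propositional using (_∈_)
open import Data.List.Membership.Propositional.Properties using (∈-++⁺ˡ; ∈-++⁺ʳ)
open import Data.List.Relation.Unary.Any using (here; there)
open import Data.Product using (_×_; ∃; ∃₂; _,_; proj₁)
open import Function using (_∘_; id)
open import Relation.Nullary using (¬_; yes; no; contradiction)
open import Relation.Nullary.Decidable using (dec-no; ⌊_⌋)
open import Relation.Binary.PropositionalEquality
  using (_≡_; refl; sym; trans; cong; cong₂; subst; subst₂; module ≡-Reasoning)

entry≤sum : ∀ {m} (g : Fin m → ℕ) j → g j ≤ sum (tabulate g)
entry≤sum g zero    = m≤m+n (g zero) _
entry≤sum g (suc j) = ≤-trans (entry≤sum (g ∘ suc) j) (m≤n+m _ (g zero))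

two-entries≤sum : ∀ {m} (g : Fin m → ℕ) j k → ¬ j ≡ k → g j + g k ≤ sum (tabulate g)
two-entries≤sum g zero    zero    j≢k = contradiction refl j≢k
two-entries≤sum g zero    (suc k) _   = +-monoʳ-≤ (g zero) (entry≤sum (g ∘ suc) k)
two-entries≤sum g (suc j) zero    _   =
  subst (_≤ sum (tabulate g)) (+-comm (g zero) (g (suc j)))
        (+-monoʳ-≤ (g zero) (entry≤sum (g ∘ suc) j))
two-entries≤sum g (suc j) (suc k) j≢k =
  ≤-trans (two-entries≤sum (g ∘ suc) j k (j≢k ∘ cong suc)) (m≤n+m _ (g zero))

leaf-neighbour-unique : ∀ {n} (G : Graph n) {ℓ j k} → Leaf G ℓ →
                        adj G ℓ j ≡ true → adj G ℓ k ≡ true → j ≡ k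
leaf-neighbour-unique {n} G {ℓ} {j} {k} leaf ℓj ℓk with j ≟ k
... | yes j≡k = j≡k
... | no  j≢k = contradiction two≤one λ { (s≤s ()) }
  where
  indicator : Fin n → ℕ
  indicator i = if adj G ℓ i then 1 else 0
  two≤deg : 2 ≤ sum (tabulate indicator)
  two≤deg = subst₂ (λ a b → a + b ≤ sum (tabulate indicator))
                   (cong (λ e → if e then 1 else 0) ℓj) (cong (λ e → if e then 1 else 0) ℓk)
                   (two-entries≤sum indicator j k j≢k)
  two≤one : 2 ≤ 1
  two≤one = subst (2 ≤_) (trans (sym (cong sum (map-tabulate id indicator))) leaf) two≤deg

leaf-neighbour-transfer : ∀ {n} (G G' : Graph n) {ℓ v y} → Leaf G ℓ →
                          adj G ℓ v ≡ true → adj G' ℓ v ≡ true → adj G ℓ y ≡ true → adj G' ℓ y ≡ true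
leaf-neighbour-transfer G G' {ℓ} leaf ℓv ℓv' ℓy =
  subst (λ z → adj G' ℓ z ≡ true) (leaf-neighbour-unique G leaf ℓv ℓy) ℓv'

leaves-with-common-neighbour : ∀ {n} (G G' : Graph n) {ℓ v} → Leaf G ℓ → Leaf G' ℓ →
                               adj G ℓ v ≡ true → adj G' ℓ v ≡ true →
                               ∀ y → adj G ℓ y ≡ adj G' ℓ y
leaves-with-common-neighbour G G' {ℓ} leaf leaf' ℓv ℓv' y
  with adj G ℓ y in ℓy | adj G' ℓ y in ℓy'
... | true  | true  = refl
... | false | false = refl
... | true  | false = trans (sym (leaf-neighbour-transfer G G' leaf ℓv ℓv' ℓy)) ℓy'
... | false | true  = sym (trans (sym (leaf-neighbour-transfer G' G leaf' ℓv' ℓv ℓy')) ℓy)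

sameEdge-≢ˡ : ∀ {n} {x y u w : Fin n} → ¬ x ≡ u → ¬ x ≡ w → sameEdge x y u w ≡ false
sameEdge-≢ˡ {x = x} {u = u} {w} x≢u x≢w rewrite dec-no (x ≟ u) x≢u | dec-no (x ≟ w) x≢w = refl

sameEdge-≢ʳ : ∀ {n} {x y u w : Fin n} → ¬ y ≡ u → ¬ y ≡ w → sameEdge x y u w ≡ false
sameEdge-≢ʳ {x = x} {y} {u} {w} y≢u y≢w rewrite dec-no (y ≟ u) y≢u | dec-no (y ≟ w) y≢w =
  cong₂ _∨_ (∧-zeroʳ ⌊ x ≟ u ⌋) (∧-zeroʳ ⌊ x ≟ w ⌋)

Avoids : ∀ {n} → Fin n → Matrix n → Set
Avoids x (mat a b c d) = ¬ x ≡ a × ¬ x ≡ b × ¬ x ≡ c × ¬ x ≡ d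

switch-fixesˡ : ∀ {n} τ (G : Graph n) {x y} → Avoids x τ → adj (switch τ G) x y ≡ adj G x y
switch-fixesˡ (mat a b c d) G {x} {y} (x≢a , x≢b , x≢c , x≢d)
  rewrite sameEdge-≢ˡ {y = y} x≢a x≢b | sameEdge-≢ˡ {y = y} x≢c x≢d
        | sameEdge-≢ˡ {y = y} x≢a x≢c | sameEdge-≢ˡ {y = y} x≢b x≢d =
  trans (∨-identityʳ _) (∧-identityʳ _)

switch-fixesʳ : ∀ {n} τ (G : Graph n) {x y} → Avoids y τ → adj (switch τ G) x y ≡ adj G x y
switch-fixesʳ (mat a b c d) G {x} {y} (y≢a , y≢b , y≢c , y≢d)
  rewrite sameEdge-≢ʳ {x = x} y≢a y≢b | sameEdge-≢ʳ {x = x} y≢c y≢d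
        | sameEdge-≢ʳ {x = x} y≢a y≢c | sameEdge-≢ʳ {x = x} y≢b y≢d =
  trans (∨-identityʳ _) (∧-identityʳ _)

switch-cong : ∀ {n} τ (G H : Graph n) {x y} → adj G x y ≡ adj H x y →
              adj (switch τ G) x y ≡ adj (switch τ H) x y
switch-cong (mat a b c d) G H {x} {y} =
  cong (λ e → (e ∧ not (sameEdge x y a b ∨ sameEdge x y c d)) ∨ sameEdge x y a c ∨ sameEdge x y b d)

2switch-interchangeable : ∀ {n} τ (G : Graph n) → Interchangeable τ G → 2switch τ G ≡ switch τ G
2switch-interchangeable (mat a b c d) G (ab , cd , a≢c , a≢d , b≢c , b≢d , ¬ac , ¬bd)
  rewrite ab | cd | dec-no (a ≟ c) a≢c | dec-no (a ≟ d) a≢d | dec-no (b ≟ c) b≢c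
        | dec-no (b ≟ d) b≢d | ¬ac | ¬bd = refl

Branching : ∀ {n} → Graph n → Fin n → Set
Branching G y = ∃₂ λ x w → ¬ x ≡ w × adj G x y ≡ true × adj G y w ≡ true

cycleVertices : ∀ {n} {G : Graph n} → Cycle G → List (Fin n)
cycleVertices C = first ∷ rest ++ last ∷ []
  where open Cycle C

module _ {n} {G : Graph n} where

  path-successor : ∀ y ys z → Path G (y ∷ ys ++ z ∷ []) →
                   ∃ λ w → w ∈ ys ++ z ∷ [] × adj G y w ≡ true
  path-successor y []       z (path-∷ _ _ _ yz _) = z , here refl , yz
  path-successor y (w ∷ ys) z (path-∷ _ _ _ yw _) = w , here refl , yw

  path-predecessor : ∀ y ys z → Path G (y ∷ ys ++ z ∷ []) →
                     ∃ λ p → p ∈ y ∷ ys × adj G p z ≡ true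
  path-predecessor y []       z (path-∷ _ _ _ yz _) = y , here refl , yz
  path-predecessor y (w ∷ ys) z (path-∷ _ _ _ _ p) with path-predecessor w ys z p
  ... | q , q∈ , qz = q , there q∈ , qz

  path-interior-branching : ∀ x ys z → Path G (x ∷ ys ++ z ∷ []) → Unique (x ∷ ys ++ z ∷ []) →
                            All (Branching G) ys
  path-interior-branching x []       z _                  _          = []
  path-interior-branching x (y ∷ ys) z (path-∷ _ _ _ xy p) (x∉ ∷ u) with path-successor y ys z p
  ... | w , w∈ , yw =
    (x , w , All.lookup x∉ (there w∈) , xy , yw) ∷ path-interior-branching y ys z p u

  cycle-branching : (C : Cycle G) → All (Branching G) (cycleVertices C)
  cycle-branching record { rest = [] ; long = () }
  cycle-branching record { first = f ; rest = r ∷ rs ; last = l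
                         ; distinct = distinct@(f∉ ∷ r∉ ∷ _) ; walk = walk@(path-∷ _ _ _ fr tail)
                         ; closed = lf } =
    branching-f ∷ ++⁺ (path-interior-branching f (r ∷ rs) l walk distinct) (branching-l ∷ [])
    where
    branching-f : Branching G f
    branching-f = l , r , (λ l≡r → All.lookup r∉ (∈-++⁺ʳ rs (here refl)) (sym l≡r)) , lf , fr
    branching-l : Branching G l
    branching-l with path-predecessor r rs l tail
    ... | p , p∈ , pl = p , f , (λ p≡f → All.lookup f∉ (∈-++⁺ˡ p∈) (sym p≡f)) , pl , lf

module _ {n} {G H : Graph n} {P : Fin n → Set}
         (keep : ∀ {x y} → P x → P y → adj G x y ≡ true → adj H x y ≡ true) where

  path-transfer : ∀ {xs} → All P xs → Path G xs → Path H xs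
  path-transfer _                path-[]              = path-[]
  path-transfer _                (path-[x] x)         = path-[x] x
  path-transfer (px ∷ py ∷ ps) (path-∷ x y vs xy p) =
    path-∷ x y vs (keep px py xy) (path-transfer (py ∷ ps) p)

  cycle-transfer : (C : Cycle G) → All P (cycleVertices C) → Cycle H
  cycle-transfer C all-P = record
    { first = first ; rest = rest ; last = last ; long = long ; distinct = distinct
    ; walk = path-transfer all-P walk
    ; closed = keep (All.lookup all-P (there (∈-++⁺ʳ rest (here refl)))) (All.head all-P) closed }
    where open Cycle C

module Lifting {n} (F : Graph n) (Λ : Fin n → Bool) (simple-F : IsSimple F)
               (leaf-at-Λ : ∀ ℓ → Λ ℓ ≡ true → Leaf F ℓ) where

  record Untrimmed (G H : Graph n) : Set where
    field
      all-vertices : ∀ i → vert G i ≡ true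
      agree-off-Λ  : ∀ x y → Λ x ≡ false → Λ y ≡ false → adj G x y ≡ adj H x y
      agree-Fˡ     : ∀ x y → Λ x ≡ true → adj G x y ≡ adj F x y
      agree-Fʳ     : ∀ x y → Λ y ≡ true → adj G x y ≡ adj F x y
      trimmedˡ     : ∀ x y → Λ x ≡ true → adj H x y ≡ false
      trimmedʳ     : ∀ x y → Λ y ≡ true → adj H x y ≡ false

  Λ-disjoint : ∀ {x u} → Λ x ≡ true → Λ u ≡ false → ¬ x ≡ u
  Λ-disjoint x∈ x∉ refl = contradiction (trans (sym x∈) x∉) λ ()

  untrimmed-trim : (∀ i → vert F i ≡ true) → Untrimmed F (F -V Λ)
  untrimmed-trim vert-F = record
    { all-vertices = vert-F
    ; agree-off-Λ  = agree-off-Λ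
    ; agree-Fˡ     = λ _ _ _ → refl
    ; agree-Fʳ     = λ _ _ _ → refl
    ; trimmedˡ     = trimmedˡ
    ; trimmedʳ     = trimmedʳ
    }
    where
    agree-off-Λ : ∀ x y → Λ x ≡ false → Λ y ≡ false → adj F x y ≡ adj (F -V Λ) x y
    agree-off-Λ x y x∉ y∉ rewrite x∉ | y∉ = sym (∧-identityʳ _)
    trimmedˡ : ∀ x y → Λ x ≡ true → adj (F -V Λ) x y ≡ false
    trimmedˡ x y x∈ rewrite x∈ = ∧-zeroʳ _
    trimmedʳ : ∀ x y → Λ y ≡ true → adj (F -V Λ) x y ≡ false
    trimmedʳ x y y∈ rewrite y∈ = trans (cong (adj F x y ∧_) (∧-zeroʳ _)) (∧-zeroʳ _)

  untrimmed-respʳ : ∀ {G H H'} → Untrimmed G H → H ≈G H' → Untrimmed G H'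
  untrimmed-respʳ u (_ , H≈H') = record
    { all-vertices = all-vertices
    ; agree-off-Λ  = λ x y x∉ y∉ → trans (agree-off-Λ x y x∉ y∉) (H≈H' x y)
    ; agree-Fˡ     = agree-Fˡ
    ; agree-Fʳ     = agree-Fʳ
    ; trimmedˡ     = λ x y x∈ → trans (sym (H≈H' x y)) (trimmedˡ x y x∈)
    ; trimmedʳ     = λ x y y∈ → trans (sym (H≈H' x y)) (trimmedʳ x y y∈)
    }
    where open Untrimmed u

  edge-off-Λ : ∀ {G H} → Untrimmed G H → ∀ {x y} → adj H x y ≡ true →
               Λ x ≡ false × Λ y ≡ false
  edge-off-Λ u {x} {y} xy with Λ x in x∈ | Λ y in y∈
  ... | true  | _     = contradiction (trans (sym xy) (Untrimmed.trimmedˡ u x y x∈)) λ ()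
  ... | false | true  = contradiction (trans (sym xy) (Untrimmed.trimmedʳ u x y y∈)) λ ()
  ... | false | false = refl , refl

  module _ {G H : Graph n} (u : Untrimmed G H) where
    open Untrimmed u

    untrimmed-simple : IsSimple H → IsSimple G
    untrimmed-simple simple-H = record
      { symm = symm ; loopless = loopless ; edgeVert = λ i _ _ → all-vertices i }
      where
      symm : ∀ x y → adj G x y ≡ adj G y x
      symm x y with Λ x in x∈ | Λ y in y∈
      ... | true  | _     =
        trans (agree-Fˡ x y x∈) (trans (IsSimple.symm simple-F x y) (sym (agree-Fʳ y x x∈)))
      ... | false | true  =
        trans (agree-Fʳ x y y∈) (trans (IsSimple.symm simple-F x y) (sym (agree-Fˡ y x y∈)))
      ... | false | false =
        trans (agree-off-Λ x y x∈ y∈) (trans (IsSimple.symm simple-H x y) (sym (agree-off-Λ y x y∈ x∈)))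
      loopless : ∀ x → adj G x x ≡ false
      loopless x with Λ x in x∈
      ... | true  = trans (agree-Fˡ x x x∈) (IsSimple.loopless simple-F x)
      ... | false = trans (agree-off-Λ x x x∈ x∈) (IsSimple.loopless simple-H x)

    branching-off-Λ : ∀ {y} → Branching G y → Λ y ≡ false
    branching-off-Λ {y} (x , w , x≢w , xy , yw) with Λ y in y∈
    ... | false = refl
    ... | true  = contradiction (leaf-neighbour-unique F (leaf-at-Λ y y∈) yx-F yw-F) x≢w
      where
      yx-F : adj F y x ≡ true
      yx-F = trans (IsSimple.symm simple-F y x) (trans (sym (agree-Fʳ x y y∈)) xy)
      yw-F : adj F y w ≡ true
      yw-F = trans (sym (agree-Fˡ y w y∈)) yw

    untrimmed-forest : Forest H → Forest G
    untrimmed-forest (simple-H , acyclic-H) =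
      untrimmed-simple simple-H ,
      λ C → acyclic-H (cycle-transfer keep C (All.map branching-off-Λ (cycle-branching C)))
      where
      keep : ∀ {x y} → Λ x ≡ false → Λ y ≡ false → adj G x y ≡ true → adj H x y ≡ true
      keep {x} {y} x∉ y∉ xy = trans (sym (agree-off-Λ x y x∉ y∉)) xy

    untrimmed-switch : ∀ τ → (∀ {v} → Λ v ≡ true → Avoids v τ) →
                       Untrimmed (switch τ G) (switch τ H)
    untrimmed-switch τ avoid = record
      { all-vertices = all-vertices
      ; agree-off-Λ  = λ x y x∉ y∉ → switch-cong τ G H (agree-off-Λ x y x∉ y∉)
      ; agree-Fˡ     = λ x y x∈ → trans (switch-fixesˡ τ G (avoid x∈)) (agree-Fˡ x y x∈)
      ; agree-Fʳ     = λ x y y∈ → trans (switch-fixesʳ τ G (avoid y∈)) (agree-Fʳ x y y∈)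
      ; trimmedˡ     = λ x y x∈ → trans (switch-fixesˡ τ H (avoid x∈)) (trimmedˡ x y x∈)
      ; trimmedʳ     = λ x y y∈ → trans (switch-fixesʳ τ H (avoid y∈)) (trimmedʳ x y y∈)
      }

  fswitch-lift : ∀ {G H} τ → Untrimmed G H → FSwitch τ H →
                 FSwitch τ G × Untrimmed (2switch τ G) (2switch τ H)
  fswitch-lift {G} {H} τ@(mat a b c d) u
    (forest-H , ich-H@(ab , cd , a≢c , a≢d , b≢c , b≢d , ¬ac , ¬bd) , forest-τH)
    with edge-off-Λ u ab | edge-off-Λ u cd
  ... | a∉ , b∉ | c∉ , d∉ =
    (untrimmed-forest u forest-H , ich-G , subst Forest (sym switched-G) forest-τG) ,
    subst₂ Untrimmed (sym switched-G) (sym switched-H) u-τ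
    where
    open Untrimmed u
    ich-G : Interchangeable τ G
    ich-G = trans (agree-off-Λ a b a∉ b∉) ab , trans (agree-off-Λ c d c∉ d∉) cd ,
            a≢c , a≢d , b≢c , b≢d ,
            trans (agree-off-Λ a c a∉ c∉) ¬ac , trans (agree-off-Λ b d b∉ d∉) ¬bd
    switched-G : 2switch τ G ≡ switch τ G
    switched-G = 2switch-interchangeable τ G ich-G
    switched-H : 2switch τ H ≡ switch τ H
    switched-H = 2switch-interchangeable τ H ich-H
    u-τ : Untrimmed (switch τ G) (switch τ H)
    u-τ = untrimmed-switch u τ λ v∈ →
      Λ-disjoint v∈ a∉ , Λ-disjoint v∈ b∉ , Λ-disjoint v∈ c∉ , Λ-disjoint v∈ d∉
    forest-τG : Forest (switch τ G)
    forest-τG = untrimmed-forest u-τ (subst Forest switched-H forest-τH)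

  fseq-lift : ∀ {τs G H H' G'} → (∀ {G} → Untrimmed G H' → G ≈G G') →
              Untrimmed G H → FSeq τs H H' → FSeq τs G G'
  fseq-lift close u (fseq-[] H≈H') = fseq-[] (close (untrimmed-respʳ u H≈H'))
  fseq-lift close u (fseq-∷ {τ} fs seq) with fswitch-lift τ u fs
  ... | fs-G , u-τ = fseq-∷ fs-G (fseq-lift close u-τ seq)

  untrimmed-trim-unique : ∀ {F' G} → IsSimple F' → (∀ i → vert F' i ≡ true) →
                          (∀ x y → Λ x ≡ true → adj F x y ≡ adj F' x y) →
                          Untrimmed G (F' -V Λ) → G ≈G F'
  untrimmed-trim-unique {F'} {G} simple-F' vert-F' agree-at-Λ u =
    (λ i → trans (all-vertices i) (sym (vert-F' i))) , same-adj
    where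
    open Untrimmed u
    open ≡-Reasoning
    same-adj : ∀ x y → adj G x y ≡ adj F' x y
    same-adj x y with Λ x in x∈ | Λ y in y∈
    ... | true  | _     = trans (agree-Fˡ x y x∈) (agree-at-Λ x y x∈)
    ... | false | true  = begin
      adj G x y   ≡⟨ agree-Fʳ x y y∈ ⟩
      adj F x y   ≡⟨ IsSimple.symm simple-F x y ⟩
      adj F y x   ≡⟨ agree-at-Λ y x y∈ ⟩
      adj F' y x  ≡⟨ IsSimple.symm simple-F' y x ⟩
      adj F' x y  ∎
    ... | false | false = begin
      adj G x y                              ≡⟨ agree-off-Λ x y x∈ y∈ ⟩
      adj F' x y ∧ not (Λ x) ∧ not (Λ y)     ≡⟨ cong₂ (λ p q → adj F' x y ∧ not p ∧ not q) x∈ y∈ ⟩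
      adj F' x y ∧ true                      ≡⟨ ∧-identityʳ _ ⟩
      adj F' x y                             ∎

lemma2 : (n : ℕ) (s : Fin n → ℕ) → Graphical s →
         (F F' : Graph n) → InF s F → InF s F' →
         (Λ : Fin n → Bool) → (∀ ℓ → Λ ℓ ≡ true → Trimmable F F' ℓ) →
         (τs : List (Matrix n)) → FSeq τs (F -V Λ) (F' -V Λ) →
         FSeq τs F F'
lemma2 n s _ F F' ((simple-F , _) , vert-F , _) ((simple-F' , _) , vert-F' , _) Λ trimmable τs seq =
  fseq-lift (untrimmed-trim-unique simple-F' vert-F' agree-at-Λ) (untrimmed-trim vert-F) seq
  where
  open Lifting F Λ simple-F (λ ℓ ℓ∈ → proj₁ (trimmable ℓ ℓ∈))
  agree-at-Λ : ∀ x y → Λ x ≡ true → adj F x y ≡ adj F' x y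
  agree-at-Λ x y x∈ with trimmable x x∈
  ... | leaf , leaf' , _ , xv , xv' = leaves-with-common-neighbour F F' leaf leaf' xv xv' y
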